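{- Let $G$ be a P1-win graph with at least two edges. If $u \to v$ is Player 1's first move in a winning strategy for Player 1, then $\deg(v) \ge 3$. In particular, the maximum degree of $G$ is at least $3$.
   Context: Trail Trap on a finite simple undirected graph $G$: Player 1 (P1) chooses a vertex, places a token on it and moves it along an incident edge $e$ to the other endpoint (a move $u\to v$ along edge $uv$). Player 2 (P2) then places their own token on any vertex and moves it along an incident edge $f \neq e$. Thereafter the players alternate, starting with P1, each moving their own token from its current vertex along an unused edge (an edge not previously traversed, in either direction, by either player) to the adjacent vertex; vertices may be revisited and the two tokens may share a vertex. The first player unable to move loses. $G$ is P1-win if P1 has a winning strategy, and P2-win otherwise. -}

module Defs where

open import Data.Nat using (ℕ; _≤_)
open import Data.Fin using (Fin)
open import Data.Bool using (Bool; true; false; T)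
open import Data.Bool.Properties using (T?)
open import Data.List using (List; []; _∷_; length; filter; allFin)
open import Data.List.Relation.Unary.Any using (Any)
open import Data.Product using (_×_; _,_; ∃; ∃-syntax)
open import Data.Sum using (_⊎_)
open import Relation.Binary.PropositionalEquality using (_≡_)
open import Relation.Nullary using (¬_)

record Graph (n : ℕ) : Set where
  field
    adj    : Fin n → Fin n → Bool
    sym    : ∀ x y → adj x y ≡ adj y x
    irrefl : ∀ x → adj x x ≡ false

open Graph public

Move : ℕ → Set
Move n = Fin n × Fin n

SameEdge : ∀ {n} → Move n → Move n → Set
SameEdge (a , b) (c , d) = (a ≡ c × b ≡ d) ⊎ (a ≡ d × b ≡ c)

Used : ∀ {n} → List (Move n) → Move n → Set
Used U e = Any (SameEdge e) U

module _ {n : ℕ} (G : Graph n) where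

  Adj : Fin n → Fin n → Set
  Adj x y = T (adj G x y)

  deg : Fin n → ℕ
  deg v = length (filter (λ w → T? (adj G v w)) (allFin n))

  AtLeastTwoEdges : Set
  AtLeastTwoEdges = ∃[ a ] ∃[ b ] ∃[ c ] ∃[ d ]
    (Adj a b × Adj c d × ¬ SameEdge (a , b) (c , d))

  -- Positions after both tokens have been placed.
  -- MoverWins x y U : the player to move (token at x) wins against the
  -- opponent (token at y), with U the list of traversals so far.
  -- Every move uses a fresh edge, so all plays are finite and these
  -- inductive definitions capture the existence of winning strategies.
  data MoverWins : Fin n → Fin n → List (Move n) → Set
  data MoverLoses : Fin n → Fin n → List (Move n) → Set

  data MoverWins where
    win : ∀ {x y U} (x' : Fin n) → Adj x x' → ¬ Used U (x , x') →
          MoverLoses y x' ((x , x') ∷ U) → MoverWins x y U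

  data MoverLoses where
    lose : ∀ {x y U} →
           (∀ (x' : Fin n) → Adj x x' → ¬ Used U (x , x') →
              MoverWins y x' ((x , x') ∷ U)) →
           MoverLoses x y U

  -- P1's opening move u → v is the first move of a winning strategy for P1:
  -- for every reply of P2 (placing its token at w and moving along an edge
  -- w w' different from u v), P1 (at v, to move) wins.
  WinningFirstMove : Fin n → Fin n → Set
  WinningFirstMove u v =
    Adj u v ×
    (∀ (w w' : Fin n) → Adj w w' → ¬ SameEdge (w , w') (u , v) →
       MoverWins v w' ((w , w') ∷ (u , v) ∷ []))

  P1Win : Set
  P1Win = ∃[ u ] ∃[ v ] WinningFirstMove u v

-- P2 may answer P1's opening u → v with any other edge, and P1's winning reply
-- leaves v along a fresh edge to some x₁ ≠ u. P2 may instead answer by moving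
-- x₁ → v (an edge distinct from uv, because x₁ ≠ u); P1's winning reply then
-- leaves v along an edge avoiding both vu and vx₁, reaching a third neighbour
-- x₂ of v. The second edge of G is needed only so that P2 can answer at all.
module Submission where

open import Defs hiding (sym)
open import Data.Nat using (ℕ; _≤_; suc; s≤s; z≤n)
open import Data.Nat.Properties using (module ≤-Reasoning)
open import Data.Fin using (Fin; _≟_)
open import Data.Product using (_×_; ∃-syntax; _,_)
open import Data.Sum using (inj₁; inj₂)
open import Data.Bool using (T)
open import Data.Bool.Properties using (T?)
open import Data.List using (List; length; filter; allFin)
open import Data.List.Properties using (length-removeAt′)
open import Data.List.Relation.Unary.Any as Any using (here; there; index)
open import Data.List.Membership.Propositional using (_∈_; _─_)
open import Data.List.Membership.Propositional.Properties using (∈-filter⁺; ∈-allFin)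
open import Relation.Binary.PropositionalEquality
  using (_≡_; _≢_; refl; sym; cong; subst)
open import Relation.Nullary using (Dec; ¬_; yes; no; contradiction)
open import Relation.Nullary.Decidable using (_×-dec_; _⊎-dec_)

module _ {A : Set} where

  ∈-─⁺ : ∀ {x y : A} {xs} (x∈xs : x ∈ xs) → y ∈ xs → y ≢ x → y ∈ xs ─ x∈xs
  ∈-─⁺ (here refl)  (here refl)  y≢x = contradiction refl y≢x
  ∈-─⁺ (here _)     (there y∈xs) _   = y∈xs
  ∈-─⁺ (there _)    (here y≡)    _   = here y≡
  ∈-─⁺ (there x∈xs) (there y∈xs) y≢x = there (∈-─⁺ x∈xs y∈xs y≢x)

  length-─ : ∀ {x : A} {xs} (x∈xs : x ∈ xs) → length xs ≡ suc (length (xs ─ x∈xs))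
  length-─ {xs = xs} x∈xs = length-removeAt′ xs (index x∈xs)

  ∈⇒1≤length : ∀ {x : A} {xs} → x ∈ xs → 1 ≤ length xs
  ∈⇒1≤length (here _)  = s≤s z≤n
  ∈⇒1≤length (there _) = s≤s z≤n

  three-distinct-∈⇒3≤length : ∀ {x y z : A} {xs} → x ∈ xs → y ∈ xs → z ∈ xs →
                              y ≢ x → z ≢ x → z ≢ y → 3 ≤ length xs
  three-distinct-∈⇒3≤length {xs = xs} x∈xs y∈xs z∈xs y≢x z≢x z≢y = begin
    3                                         ≤⟨ s≤s (s≤s (∈⇒1≤length z∈xs─x─y)) ⟩
    suc (suc (length ((xs ─ x∈xs) ─ y∈xs─x))) ≡⟨ cong suc (length-─ y∈xs─x) ⟨
    suc (length (xs ─ x∈xs))                  ≡⟨ length-─ x∈xs ⟨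
    length xs                                 ∎
    where
    open ≤-Reasoning
    y∈xs─x = ∈-─⁺ x∈xs y∈xs y≢x
    z∈xs─x─y = ∈-─⁺ y∈xs─x (∈-─⁺ x∈xs z∈xs z≢x) z≢y

module _ {n : ℕ} where

  SameEdge-sym : {e f : Move n} → SameEdge e f → SameEdge f e
  SameEdge-sym (inj₁ (refl , refl)) = inj₁ (refl , refl)
  SameEdge-sym (inj₂ (refl , refl)) = inj₂ (refl , refl)

  SameEdge-trans : {e f g : Move n} → SameEdge e f → SameEdge f g → SameEdge e g
  SameEdge-trans (inj₁ (refl , refl)) q                    = q
  SameEdge-trans (inj₂ (refl , refl)) (inj₁ (refl , refl)) = inj₂ (refl , refl)
  SameEdge-trans (inj₂ (refl , refl)) (inj₂ (refl , refl)) = inj₁ (refl , refl)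

  SameEdge? : (e f : Move n) → Dec (SameEdge e f)
  SameEdge? (a , b) (c , d) = ((a ≟ c) ×-dec (b ≟ d)) ⊎-dec ((a ≟ d) ×-dec (b ≟ c))

  ≢⇒¬SameEdge-into : {x u v : Fin n} → x ≢ u → u ≢ v → ¬ SameEdge (x , v) (u , v)
  ≢⇒¬SameEdge-into x≢u _   (inj₁ (x≡u , _)) = x≢u x≡u
  ≢⇒¬SameEdge-into _   u≢v (inj₂ (_ , v≡u)) = u≢v (sym v≡u)

  ∈⇒reverse-Used : ∀ {U : List (Move n)} {a b} → (b , a) ∈ U → Used U (a , b)
  ∈⇒reverse-Used = Any.map λ { refl → inj₂ (refl , refl) }

  fresh⇒≢ : ∀ {U : List (Move n)} {v x y} → ¬ Used U (v , x) → (y , v) ∈ U → x ≢ y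
  fresh⇒≢ fresh yv∈U refl = fresh (∈⇒reverse-Used yv∈U)

module _ {n : ℕ} (G : Graph n) where

  Adj-sym : ∀ {x y} → Adj G x y → Adj G y x
  Adj-sym {x} {y} = subst T (Graph.sym G x y)

  Adj⇒≢ : ∀ {x y} → Adj G x y → x ≢ y
  Adj⇒≢ {x} xy refl = subst T (irrefl G x) xy

  three-neighbours⇒3≤deg : ∀ {v x y z} → Adj G v x → Adj G v y → Adj G v z →
                           y ≢ x → z ≢ x → z ≢ y → 3 ≤ deg G v
  three-neighbours⇒3≤deg {v} vx vy vz =
    three-distinct-∈⇒3≤length (neighbour vx) (neighbour vy) (neighbour vz)
    where
    neighbour : ∀ {w} → Adj G v w → w ∈ filter (λ w → T? (adj G v w)) (allFin n)
    neighbour {w} = ∈-filter⁺ (λ w → T? (adj G v w)) (∈-allFin w)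

  edge-other-than : AtLeastTwoEdges G → ∀ e →
                    ∃[ w ] ∃[ w' ] (Adj G w w' × ¬ SameEdge (w , w') e)
  edge-other-than (a , b , c , d , ab , cd , ab≉cd) e with SameEdge? (a , b) e | SameEdge? (c , d) e
  ... | no ab≉e | _        = a , b , ab , ab≉e
  ... | yes _   | no cd≉e  = c , d , cd , cd≉e
  ... | yes ab≈e | yes cd≈e = contradiction (SameEdge-trans ab≈e (SameEdge-sym cd≈e)) ab≉cd

  WinningFirstMove⇒3≤deg : AtLeastTwoEdges G → ∀ u v → WinningFirstMove G u v → 3 ≤ deg G v
  WinningFirstMove⇒3≤deg two-edges u v (uv , replies) with edge-other-than two-edges (u , v)
  ... | w , w' , ww' , ww'≉uv with replies w w' ww' ww'≉uv
  ... | win x₁ vx₁ fresh₁ _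
    with replies x₁ v (Adj-sym vx₁)
                 (≢⇒¬SameEdge-into (fresh⇒≢ fresh₁ (there (here refl))) (Adj⇒≢ uv))
  ... | win x₂ vx₂ fresh₂ _ =
    three-neighbours⇒3≤deg (Adj-sym uv) vx₁ vx₂
      (fresh⇒≢ fresh₁ (there (here refl)))
      (fresh⇒≢ fresh₂ (there (here refl)))
      (fresh⇒≢ fresh₂ (here refl))

proposition2p2 : ∀ {n : ℕ} (G : Graph n) → P1Win G → AtLeastTwoEdges G →
    (∀ (u v : Fin n) → WinningFirstMove G u v → 3 ≤ deg G v)
    × (∃[ w ] 3 ≤ deg G w)
proposition2p2 G (u , v , uv-wins) two-edges =
  WinningFirstMove⇒3≤deg G two-edges , v , WinningFirstMove⇒3≤deg G two-edges u v uv-wins
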